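{- Let $j, k, \ell \in \mathbb{N}^+$ with $j < k$ and $3 \le \ell \le j+2$. Then the number of ways to split $2k+j$ balls into exactly $\ell$ nonempty ordered bins so that at least two bins have exactly $k$ balls is $$G_{2k+j,\ell,k,2} = \frac{\ell^2-\ell}{2}\binom{j-1}{\ell-3}.$$
   Context: $G_{2k+j,\ell,k,2}$ denotes the number of $(x_1,\dots,x_\ell)\in(\mathbb{Z}_{>0})^\ell$ with $\sum x_m = 2k+j$ having at least two coordinates equal to $k$. -}

module Defs where

open import Data.Nat using (ℕ; zero; suc; _+_; _≤?_; _≟_)
open import Data.Bool using (if_then_else_)
open import Data.List using (List; []; _∷_; map; concatMap; length; filter; upTo)
open import Data.Vec using (Vec; []; _∷_)
open import Relation.Nullary using (does)

-- Each composition appears exactly once: the first coordinate x₁ = suc i ranges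
-- over 1 … n (i ∈ upTo n), and the rest is a composition of n ∸ suc i into ℓ parts.
compositions : ℕ → (ℓ : ℕ) → List (Vec ℕ ℓ)
compositionsAfter : ℕ → ℕ → (ℓ : ℕ) → List (Vec ℕ ℓ)

compositions zero    zero    = [] ∷ []
compositions (suc n) zero    = []
compositions n       (suc ℓ) =
  concatMap (λ i → map (suc i ∷_) (compositionsAfter n i ℓ)) (upTo n)

-- compositionsAfter n i ℓ = compositions (n ∸ suc i) ℓ when suc i ≤ n, else []
compositionsAfter zero    _       ℓ = []
compositionsAfter (suc m) zero    ℓ = compositions m ℓ
compositionsAfter (suc m) (suc i) ℓ = compositionsAfter m i ℓ

countEq : ∀ {ℓ} → ℕ → Vec ℕ ℓ → ℕ
countEq k []       = 0
countEq k (x ∷ xs) = if does (x ≟ k) then suc (countEq k xs) else countEq k xs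

G : ℕ → ℕ → ℕ → ℕ → ℕ
G n ℓ k t = length (filter (λ v → t ≤? countEq k v) (compositions n ℓ))

-- If s < k, a composition of t * k + s has at most t parts equal to k, and when it has
-- exactly t of them the other ℓ ∸ t parts form a composition of s.  So G (t * k + s) ℓ k t
-- is ℓ C t times the number of compositions of s into ℓ ∸ t parts.  This goes by induction
-- on ℓ, splitting on the first part x: for x ≤ s the rest is a composition of t * k + r
-- with r < s, for x = k it is one of (t ∸ 1) * k + s, and for any other x the rest is too
-- small to have t parts equal to k.  Compositions of m + 1 into p + 1 parts number m C p.

module Submission where

open import Defs
open import Data.Nat using (ℕ; _+_; _*_; _∸_; _/_; _≤_; _<_)
open import Data.Nat.Combinatorics using (_C_)
open import Relation.Binary.PropositionalEquality using (_≡_)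

open import Data.Nat using (zero; suc; z≤n; s≤s; s≤s⁻¹; _≟_; _≤?_; _<?_)
open import Data.Nat.Properties
open import Data.Nat.DivMod using (m*n/n≡m)
open import Data.Nat.Combinatorics using (nC1≡n; nCk+nC[k+1]≡[n+1]C[k+1]; k>n⇒nCk≡0)
open import Data.Nat.Tactic.RingSolver using (solve-∀)
open import Data.List using (List; []; _∷_; _++_; map; length; filter; concatMap; applyUpTo)
open import Data.List.Properties using (length-++; filter-++; filter-≐; filter-all)
open import Data.List.Relation.Unary.All using (universal; universal-U)
open import Data.Vec using (Vec; _∷_)
open import Data.Bool using (true; false)
open import Data.Product using (_,_)
open import Function using (_∘_)
open import Relation.Nullary using (yes; no; does)
open import Relation.Nullary.Decidable using (dec-true; dec-false)
open import Relation.Unary using (Decidable)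
open import Relation.Unary.Properties using (U?)
open import Relation.Binary.PropositionalEquality
  using (_≢_; refl; sym; trans; cong; cong₂; subst; module ≡-Reasoning)
open ≡-Reasoning

-- splits f n = Σ f i r over all i, r with suc i + r ≡ n.
splits : (ℕ → ℕ → ℕ) → ℕ → ℕ
splits f zero    = 0
splits f (suc n) = f 0 n + splits (f ∘ suc) n

splits-cong : ∀ {f g} n → (∀ i r → suc i + r ≡ n → f i r ≡ g i r) → splits f n ≡ splits g n
splits-cong zero    f≗g = refl
splits-cong (suc n) f≗g =
  cong₂ _+_ (f≗g 0 n refl) (splits-cong n (λ i r e → f≗g (suc i) r (cong suc e)))

splits-zero : ∀ {f} n → (∀ i r → suc i + r ≡ n → f i r ≡ 0) → splits f n ≡ 0
splits-zero zero    f≗0 = refl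
splits-zero (suc n) f≗0 =
  cong₂ _+_ (f≗0 0 n refl) (splits-zero n (λ i r e → f≗0 (suc i) r (cong suc e)))

splits-point : ∀ {f} n c {r₀} → suc c + r₀ ≡ n →
  (∀ i r → suc i + r ≡ n → i ≢ c → f i r ≡ 0) → splits f n ≡ f c r₀
splits-point {f} (suc n) zero refl f≗0 =
  trans (cong (f 0 n +_) (splits-zero n (λ i r e → f≗0 (suc i) r (cong suc e) λ ())))
        (+-identityʳ _)
splits-point (suc n) (suc c) e    f≗0 =
  cong₂ _+_ (f≗0 0 n refl λ ())
            (splits-point n c (suc-injective e)
              (λ i r e′ i≢c → f≗0 (suc i) r (cong suc e′) (i≢c ∘ suc-injective)))

splits-+ : ∀ f m n → splits f (m + n) ≡ splits (λ i r → f i (r + n)) m + splits (λ i → f (m + i)) n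
splits-+ f zero    n = refl
splits-+ f (suc m) n =
  trans (cong (f 0 (m + n) +_) (splits-+ (f ∘ suc) m n)) (sym (+-assoc (f 0 (m + n)) _ _))

splits-* : ∀ c f n → splits (λ i r → c * f i r) n ≡ c * splits f n
splits-* c f zero    = sym (*-zeroʳ c)
splits-* c f (suc n) =
  trans (cong (c * f 0 n +_) (splits-* c (f ∘ suc) n)) (sym (*-distribˡ-+ c (f 0 n) _))

compositionsAfter-+ : ∀ d m ℓ → compositionsAfter (d + suc m) d ℓ ≡ compositions m ℓ
compositionsAfter-+ zero    m ℓ = refl
compositionsAfter-+ (suc d) m ℓ = compositionsAfter-+ d m ℓ

length-filter-map : ∀ {A B : Set} {P : B → Set} (P? : Decidable P) (f : A → B) xs →
  length (filter P? (map f xs)) ≡ length (filter (P? ∘ f) xs)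
length-filter-map P? f []       = refl
length-filter-map P? f (x ∷ xs) with does (P? (f x))
... | true  = cong suc (length-filter-map P? f xs)
... | false = length-filter-map P? f xs

module _ {ℓ} {P : Vec ℕ (suc ℓ) → Set} (P? : Decidable P) where

  private
    withFirstPart : ℕ → ℕ → ℕ
    withFirstPart x r = length (filter (λ v → P? (x ∷ v)) (compositions r ℓ))

    -- For f i = d + i, firstParts (d + n) f n lists the compositions of d + n whose first part exceeds d.
    firstParts : ℕ → (ℕ → ℕ) → ℕ → List (Vec ℕ (suc ℓ))
    firstParts m f n = concatMap (λ i → map (suc i ∷_) (compositionsAfter m i ℓ)) (applyUpTo f n)

    length-filter-firstParts : ∀ f n → (∀ i → f (suc i) ≡ suc (f i)) →
      length (filter P? (firstParts (f 0 + n) f n)) ≡ splits (λ i → withFirstPart (suc (f i))) n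
    length-filter-firstParts f zero    f-suc = refl
    length-filter-firstParts f (suc n) f-suc = begin
      length (filter P? (first ++ rest))                    ≡⟨ cong length (filter-++ P? first rest) ⟩
      length (filter P? first ++ filter P? rest)            ≡⟨ length-++ (filter P? first) ⟩
      length (filter P? first) + length (filter P? rest)    ≡⟨ cong₂ _+_ first≡ rest≡ ⟩
      withFirstPart (suc (f 0)) n + splits (λ i → withFirstPart (suc (f (suc i)))) n ∎
      where
      first rest : List (Vec ℕ (suc ℓ))
      first = map (suc (f 0) ∷_) (compositionsAfter (f 0 + suc n) (f 0) ℓ)
      rest  = firstParts (f 0 + suc n) (f ∘ suc) n
      first≡ : length (filter P? first) ≡ withFirstPart (suc (f 0)) n
      first≡ = trans (length-filter-map P? (suc (f 0) ∷_) (compositionsAfter (f 0 + suc n) (f 0) ℓ))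
                     (cong (length ∘ filter (λ v → P? (suc (f 0) ∷ v))) (compositionsAfter-+ (f 0) n ℓ))
      rest≡ : length (filter P? rest) ≡ splits (λ i → withFirstPart (suc (f (suc i)))) n
      rest≡ = trans (cong (λ m → length (filter P? (firstParts m (f ∘ suc) n)))
                          (trans (+-suc (f 0) n) (cong (_+ n) (sym (f-suc 0)))))
                    (length-filter-firstParts (f ∘ suc) n (f-suc ∘ suc))

  length-filter-compositions-suc : ∀ n →
    length (filter P? (compositions n (suc ℓ))) ≡
    splits (λ i r → length (filter (λ v → P? (suc i ∷ v)) (compositions r ℓ))) n
  length-filter-compositions-suc zero    = refl
  length-filter-compositions-suc (suc n) = length-filter-firstParts (λ i → i) (suc n) (λ _ → refl)

length-filter-U : ∀ {A : Set} (xs : List A) → length (filter U? xs) ≡ length xs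
length-filter-U xs = cong length (filter-all U? (universal-U xs))

length-compositions-suc : ∀ n ℓ →
  length (compositions n (suc ℓ)) ≡ splits (λ _ r → length (compositions r ℓ)) n
length-compositions-suc n ℓ = begin
  length (compositions n (suc ℓ))
    ≡⟨ length-filter-U (compositions n (suc ℓ)) ⟨
  length (filter U? (compositions n (suc ℓ)))
    ≡⟨ length-filter-compositions-suc U? n ⟩
  splits (λ _ r → length (filter U? (compositions r ℓ))) n
    ≡⟨ splits-cong n (λ _ r _ → length-filter-U (compositions r ℓ)) ⟩
  splits (λ _ r → length (compositions r ℓ)) n ∎

splits-length-compositions : ∀ ℓ m → splits (λ _ r → length (compositions r ℓ)) (suc m) ≡ m C ℓ
splits-length-compositions zero    zero    = refl
splits-length-compositions zero    (suc m) = splits-length-compositions zero m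
splits-length-compositions (suc ℓ) zero    = refl
splits-length-compositions (suc ℓ) (suc m) = begin
  length (compositions (suc m) (suc ℓ)) + splits (λ _ r → length (compositions r (suc ℓ))) (suc m)
    ≡⟨ cong₂ _+_ (trans (length-compositions-suc (suc m) ℓ) (splits-length-compositions ℓ m))
                 (splits-length-compositions (suc ℓ) m) ⟩
  m C ℓ + m C suc ℓ
    ≡⟨ nCk+nC[k+1]≡[n+1]C[k+1] m ℓ ⟩
  suc m C suc ℓ ∎

length-compositions : ∀ m ℓ → length (compositions (suc m) (suc ℓ)) ≡ m C ℓ
length-compositions m ℓ = trans (length-compositions-suc (suc m) ℓ) (splits-length-compositions ℓ m)

-- _C_ (infixl 6.5) binds more loosely than _*_, hence the parentheses around n C 2.
nC2*2+n≡n*n : ∀ n → (n C 2) * 2 + n ≡ n * n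
nC2*2+n≡n*n zero    = refl
nC2*2+n≡n*n (suc n) = begin
  (suc n C 2) * 2 + suc n          ≡⟨ cong (λ c → c * 2 + suc n) (nCk+nC[k+1]≡[n+1]C[k+1] n 1) ⟨
  (n C 1 + n C 2) * 2 + suc n      ≡⟨ cong (λ c → (c + n C 2) * 2 + suc n) (nC1≡n n) ⟩
  (n + n C 2) * 2 + suc n          ≡⟨ regroup n (n C 2) ⟩
  ((n C 2) * 2 + n) + (n + suc n)  ≡⟨ cong (_+ (n + suc n)) (nC2*2+n≡n*n n) ⟩
  n * n + (n + suc n)              ≡⟨ square-suc n ⟩
  suc n * suc n                    ∎
  where
  regroup : ∀ n c → (n + c) * 2 + suc n ≡ (c * 2 + n) + (n + suc n)
  regroup = solve-∀
  square-suc : ∀ n → n * n + (n + suc n) ≡ suc n * suc n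
  square-suc = solve-∀

[n*n∸n]/2≡nC2 : ∀ n → (n * n ∸ n) / 2 ≡ n C 2
[n*n∸n]/2≡nC2 n = begin
  (n * n ∸ n) / 2            ≡⟨ cong (λ m → (m ∸ n) / 2) (nC2*2+n≡n*n n) ⟨
  ((n C 2) * 2 + n ∸ n) / 2  ≡⟨ cong (_/ 2) (m+n∸n≡m ((n C 2) * 2) n) ⟩
  (n C 2) * 2 / 2            ≡⟨ m*n/n≡m (n C 2) 2 ⟩
  n C 2                      ∎

pascal-weighted : ∀ n k (h : ℕ → ℕ) →
  (n C suc k) * h (suc (n ∸ suc k)) + (n C k) * h (n ∸ k) ≡ (suc n C suc k) * h (n ∸ k)
pascal-weighted n k h = begin
  (n C suc k) * h (suc (n ∸ suc k)) + (n C k) * h (n ∸ k)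
    ≡⟨ cong (_+ (n C k) * h (n ∸ k)) shift ⟩
  (n C suc k) * h (n ∸ k) + (n C k) * h (n ∸ k)
    ≡⟨ *-distribʳ-+ (h (n ∸ k)) (n C suc k) (n C k) ⟨
  (n C suc k + n C k) * h (n ∸ k)
    ≡⟨ cong (_* h (n ∸ k)) (trans (+-comm (n C suc k) (n C k)) (nCk+nC[k+1]≡[n+1]C[k+1] n k)) ⟩
  (suc n C suc k) * h (n ∸ k) ∎
  where
  -- suc (n ∸ suc k) and n ∸ k differ only when k ≥ n, where n C suc k vanishes.
  shift : (n C suc k) * h (suc (n ∸ suc k)) ≡ (n C suc k) * h (n ∸ k)
  shift with k <? n
  ... | yes k<n = cong (λ m → (n C suc k) * h m) (sym (+-∸-assoc 1 k<n))
  ... | no  k≮n rewrite k>n⇒nCk≡0 (s≤s (≮⇒≥ k≮n)) = refl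

countEq-∷-≡ : ∀ {ℓ} k x (v : Vec ℕ ℓ) → x ≡ k → countEq k (x ∷ v) ≡ suc (countEq k v)
countEq-∷-≡ k x v x≡k rewrite dec-true (x ≟ k) x≡k = refl

countEq-∷-≢ : ∀ {ℓ} k x (v : Vec ℕ ℓ) → x ≢ k → countEq k (x ∷ v) ≡ countEq k v
countEq-∷-≢ k x v x≢k rewrite dec-false (x ≟ k) x≢k = refl

G∷ : ℕ → ℕ → ℕ → ℕ → ℕ → ℕ
G∷ x r ℓ k t = length (filter (λ v → t ≤? countEq k (x ∷ v)) (compositions r ℓ))

G-suc : ∀ n ℓ k t → G n (suc ℓ) k t ≡ splits (λ i r → G∷ (suc i) r ℓ k t) n
G-suc n ℓ k t = length-filter-compositions-suc (λ v → t ≤? countEq k v) n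

G∷-≢ : ∀ {x k} r ℓ t → x ≢ k → G∷ x r ℓ k t ≡ G r ℓ k t
G∷-≢ {x} {k} r ℓ t x≢k =
  cong length (filter-≐ (λ v → t ≤? countEq k (x ∷ v)) (λ v → t ≤? countEq k v)
                        ((λ {v} → to v) , (λ {v} → from v)) (compositions r ℓ))
  where
  to : ∀ (v : Vec ℕ ℓ) → t ≤ countEq k (x ∷ v) → t ≤ countEq k v
  to v = subst (t ≤_) (countEq-∷-≢ k x v x≢k)
  from : ∀ (v : Vec ℕ ℓ) → t ≤ countEq k v → t ≤ countEq k (x ∷ v)
  from v = subst (t ≤_) (sym (countEq-∷-≢ k x v x≢k))

G∷-≡ : ∀ {x k} r ℓ t → x ≡ k → G∷ x r ℓ k (suc t) ≡ G r ℓ k t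
G∷-≡ {x} {k} r ℓ t x≡k =
  cong length (filter-≐ (λ v → suc t ≤? countEq k (x ∷ v)) (λ v → t ≤? countEq k v)
                        ((λ {v} → to v) , (λ {v} → from v)) (compositions r ℓ))
  where
  to : ∀ (v : Vec ℕ ℓ) → suc t ≤ countEq k (x ∷ v) → t ≤ countEq k v
  to v = s≤s⁻¹ ∘ subst (suc t ≤_) (countEq-∷-≡ k x v x≡k)
  from : ∀ (v : Vec ℕ ℓ) → t ≤ countEq k v → suc t ≤ countEq k (x ∷ v)
  from v = subst (suc t ≤_) (sym (countEq-∷-≡ k x v x≡k)) ∘ s≤s

G-threshold-zero : ∀ n ℓ k → G n ℓ k 0 ≡ length (compositions n ℓ)
G-threshold-zero n ℓ k = cong length (filter-all _ (universal (λ _ → z≤n) (compositions n ℓ)))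

G-no-parts : ∀ n k t → G n 0 k (suc t) ≡ 0
G-no-parts zero    k t = refl
G-no-parts (suc n) k t = refl

G-vanish : ∀ {k} n ℓ t → n < t * k → G n ℓ k t ≡ 0
G-vanish     n ℓ       zero    ()
G-vanish {k} n zero    (suc t) _    = G-no-parts n k t
G-vanish {k} n (suc ℓ) (suc t) n<tk = trans (G-suc n ℓ k (suc t)) (splits-zero n first-part)
  where
  first-part : ∀ i r → suc i + r ≡ n → G∷ (suc i) r ℓ k (suc t) ≡ 0
  first-part i r e with suc i ≟ k
  ... | yes i+1≡k = trans (G∷-≡ r ℓ t i+1≡k) (G-vanish r ℓ t (+-cancelˡ-< k r (t * k) k+r<k+tk))
    where
    k+r<k+tk : k + r < k + t * k
    k+r<k+tk = subst (_< suc t * k) (trans (sym e) (cong (_+ r) i+1≡k)) n<tk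
  ... | no  i+1≢k = trans (G∷-≢ r ℓ (suc t) i+1≢k) (G-vanish r ℓ (suc t) (≤-<-trans r≤n n<tk))
    where
    r≤n : r ≤ n
    r≤n = subst (r ≤_) e (m≤n+m r (suc i))

G[t*k+s] : ∀ {k s} t ℓ → s < k → G (t * k + s) ℓ k t ≡ (ℓ C t) * length (compositions s (ℓ ∸ t))
G[t*k+s] {k} {s} zero    ℓ       s<k = trans (G-threshold-zero s ℓ k) (sym (*-identityˡ _))
G[t*k+s] {k} {s} (suc t) zero    s<k = G-no-parts (suc t * k + s) k t
G[t*k+s] {k} {s} (suc t) (suc ℓ) s<k = begin
  G (suc t * k + s) (suc ℓ) k (suc t)
    ≡⟨ G-suc (suc t * k + s) ℓ k (suc t) ⟩
  splits F (suc t * k + s)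
    ≡⟨ cong (splits F) (+-comm (suc t * k) s) ⟩
  splits F (s + suc t * k)
    ≡⟨ splits-+ F s (suc t * k) ⟩
  splits (λ i r → F i (r + suc t * k)) s + splits (λ i → F (s + i)) (suc t * k)
    ≡⟨ cong₂ _+_ first-part-≤-s first-part->-s ⟩
  (ℓ C suc t) * L (suc (ℓ ∸ suc t)) + (ℓ C t) * L (ℓ ∸ t)
    ≡⟨ pascal-weighted ℓ t L ⟩
  (suc ℓ C suc t) * L (ℓ ∸ t) ∎
  where
  F : ℕ → ℕ → ℕ
  F i r = G∷ (suc i) r ℓ k (suc t)

  L : ℕ → ℕ
  L m = length (compositions s m)

  first-part-≤-s : splits (λ i r → F i (r + suc t * k)) s ≡ (ℓ C suc t) * L (suc (ℓ ∸ suc t))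
  first-part-≤-s = begin
    splits (λ i r → F i (r + suc t * k)) s
      ≡⟨ splits-cong s small-first-part ⟩
    splits (λ _ r → (ℓ C suc t) * length (compositions r (ℓ ∸ suc t))) s
      ≡⟨ splits-* (ℓ C suc t) (λ _ r → length (compositions r (ℓ ∸ suc t))) s ⟩
    (ℓ C suc t) * splits (λ _ r → length (compositions r (ℓ ∸ suc t))) s
      ≡⟨ cong ((ℓ C suc t) *_) (length-compositions-suc s (ℓ ∸ suc t)) ⟨
    (ℓ C suc t) * L (suc (ℓ ∸ suc t)) ∎
    where
    small-first-part : ∀ i r → suc i + r ≡ s →
      F i (r + suc t * k) ≡ (ℓ C suc t) * length (compositions r (ℓ ∸ suc t))
    small-first-part i r e = begin
      F i (r + suc t * k)             ≡⟨ G∷-≢ (r + suc t * k) ℓ (suc t) i+1≢k ⟩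
      G (r + suc t * k) ℓ k (suc t)   ≡⟨ cong (λ n → G n ℓ k (suc t)) (+-comm r (suc t * k)) ⟩
      G (suc t * k + r) ℓ k (suc t)   ≡⟨ G[t*k+s] (suc t) ℓ r<k ⟩
      (ℓ C suc t) * length (compositions r (ℓ ∸ suc t)) ∎
      where
      r<k : r < k
      r<k = ≤-<-trans (subst (r ≤_) e (m≤n+m r (suc i))) s<k
      i+1≢k : suc i ≢ k
      i+1≢k i+1≡k = <-irrefl i+1≡k (≤-<-trans (subst (suc i ≤_) e (m≤m+n (suc i) r)) s<k)

  d : ℕ
  d = k ∸ suc s

  s+1+d≡k : suc s + d ≡ k
  s+1+d≡k = m+[n∸m]≡n s<k

  first-part->-s : splits (λ i → F (s + i)) (suc t * k) ≡ (ℓ C t) * L (ℓ ∸ t)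
  first-part->-s = begin
    splits (λ i → F (s + i)) (suc t * k)   ≡⟨ splits-point (suc t * k) d d+1+[s+tk]≡[t+1]k only-k ⟩
    F (s + d) (s + t * k)                  ≡⟨ G∷-≡ (s + t * k) ℓ t s+1+d≡k ⟩
    G (s + t * k) ℓ k t                    ≡⟨ cong (λ n → G n ℓ k t) (+-comm s (t * k)) ⟩
    G (t * k + s) ℓ k t                    ≡⟨ G[t*k+s] t ℓ s<k ⟩
    (ℓ C t) * L (ℓ ∸ t)                    ∎
    where
    regroup : ∀ d s q → suc d + (s + q) ≡ suc s + d + q
    regroup = solve-∀
    d+1+[s+tk]≡[t+1]k : suc d + (s + t * k) ≡ suc t * k
    d+1+[s+tk]≡[t+1]k = trans (regroup d s (t * k)) (cong (_+ t * k) s+1+d≡k)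
    only-k : ∀ i r → suc i + r ≡ suc t * k → i ≢ d → F (s + i) r ≡ 0
    only-k i r e i≢d =
      trans (G∷-≢ r ℓ (suc t) s+1+i≢k) (G-vanish r ℓ (suc t) (subst (r <_) e (m<n+m r (s≤s z≤n))))
      where
      s+1+i≢k : suc s + i ≢ k
      s+1+i≢k eq = i≢d (+-cancelˡ-≡ (suc s) i d (trans eq (sym s+1+d≡k)))

mainTheorem11 : (j k ℓ : ℕ) → 1 ≤ j → 1 ≤ k → 1 ≤ ℓ → j < k → 3 ≤ ℓ → ℓ ≤ j + 2 →
    G (2 * k + j) ℓ k 2 ≡ ((ℓ * ℓ ∸ ℓ) / 2) * ((j ∸ 1) C (ℓ ∸ 3))
mainTheorem11 (suc j) k ℓ@(suc (suc (suc m))) (s≤s z≤n) _ _ j<k (s≤s (s≤s (s≤s z≤n))) _ = begin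
  G (2 * k + suc j) ℓ k 2
    ≡⟨ G[t*k+s] 2 ℓ j<k ⟩
  (ℓ C 2) * length (compositions (suc j) (suc m))
    ≡⟨ cong₂ _*_ (sym ([n*n∸n]/2≡nC2 ℓ)) (length-compositions j m) ⟩
  ((ℓ * ℓ ∸ ℓ) / 2) * (j C m) ∎
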